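{- Let $k\ge9$ and $n\le k/3$ be odd positive integers. Then $\mathrm{Pol}(\mathbf C_k,\mathbf C_3)$ contains an $n$-ary function $c_n$, a 6-ary function $s$ and a 6-ary function $o$ such that, for all values of the variables in $V(C_k)$: (1) $c_n(x_1,\dots,x_n)=c_n(x_2,\dots,x_n,x_1)$; (2) $s(x,y,x,z,y,z)=s(y,x,z,x,z,y)$; and (3) $o(x,x,y,y,y,x)=o(x,y,x,y,x,y)=o(y,x,x,x,y,y)$.
   Context: $\mathbf C_m$ is the $m$-cycle on $\{0,\dots,m-1\}$, vertices adjacent iff they differ by $1$ mod $m$. The direct power $\mathbf C_k^n$ has vertex set $V(C_k)^n$, $(\bar u,\bar v)$ an edge iff $(u_j,v_j)\in E(C_k)$ for all $j$. $\mathrm{Pol}(\mathbf C_k,\mathbf C_3)$ is the set of all graph homomorphisms $\mathbf C_k^n\to\mathbf C_3$, $n\ge1$ (functions $V(C_k)^n\to V(C_3)$). -}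

module Defs where

open import Data.Nat using (ℕ; zero; suc; _%_; NonZero)
open import Data.Fin using (Fin; toℕ; fromℕ<)
open import Data.Nat.DivMod using (m%n<n)
open import Data.Sum using (_⊎_)
open import Relation.Binary.PropositionalEquality using (_≡_)
open import Data.Vec.Functional using (Vector; []; _∷_)

CycleEdge : (m : ℕ) → .{{NonZero m}} → Fin m → Fin m → Set
CycleEdge m u v = (toℕ v ≡ suc (toℕ u) % m) ⊎ (toℕ u ≡ suc (toℕ v) % m)

Op : ℕ → ℕ → ℕ → Set
Op k n m = (Fin n → Fin k) → Fin m

IsPol : (k m : ℕ) .{{_ : NonZero k}} .{{_ : NonZero m}} (n : ℕ) → Op k n m → Set
IsPol k m n f = ∀ (u v : Fin n → Fin k) →
  (∀ j → CycleEdge k (u j) (v j)) → CycleEdge m (f u) (f v)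

shift : ∀ {n} {A : Set} → (Fin n → A) → (Fin n → A)
shift {n} x i = x (fromℕ< (m%n<n (suc (toℕ i)) n))
  where instance
    _ : NonZero n
    _ = nz i
      where
        nz : ∀ {n} → Fin n → NonZero n
        nz {suc n} _ = _

tup6 : ∀ {A : Set} → A → A → A → A → A → A → (Fin 6 → A)
tup6 a b c d e f = a ∷ b ∷ c ∷ d ∷ e ∷ f ∷ []

IsOdd : ℕ → Set
IsOdd n = n % 2 ≡ 1

-- Let h = (k + 1) / 2, the inverse of 2 modulo k, and colour a tuple by the third of
-- {0, …, k − 1} containing h · Σ xᵢ mod k.  Along an edge of C_k^m, r coordinates step up
-- and s step down, so twice the halved sum moves by r − s modulo k: an odd number of
-- absolute value at most k / 3.  Two points t, t′ of the same third satisfy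
-- |2t − 2t′| < 2k / 3, so 2t′ − 2t ≡ r − s forces 2t′ − 2t = r − s, which parity forbids.
-- Adjacent tuples therefore get distinct, hence adjacent, vertices of C_3.  The colouring
-- only sees the sum of its arguments, which gives the cyclic c_n and, as ternary minors,
-- s and o.
module Submission where

open import Defs
open import Data.Nat using (ℕ; _≤_; _*_; suc; NonZero)
open import Data.Fin using (Fin)
open import Data.Product using (Σ; _×_)
open import Relation.Binary.PropositionalEquality using (_≡_)

open import Data.Fin using (zero; suc; toℕ; fromℕ<; fromℕ; inject₁; #_)
open import Data.Fin.Properties using (toℕ-fromℕ<; toℕ-injective; toℕ-inject₁; toℕ-fromℕ; toℕ<n; fromℕ<-injective)
open import Data.Nat using (zero; _+_; _<_; _%_; _/_; s<s)
open import Data.Nat.DivMod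
open import Data.Nat.Properties
open import Data.Nat.Tactic.RingSolver using (solve-∀)
open import Algebra.Properties.Monoid.Sum +-0-monoid using (sum; sum-cong-≗; sum-init-last)
open import Data.Product using (_,_; ∃₂)
open import Data.Sum using (_⊎_; inj₁; inj₂)
open import Data.Vec.Functional using (Vector; head; tail; init; last; rearrange; _∷_; [])
open import Function using (_∘_; case_of_)
open import Relation.Binary.PropositionalEquality using (_≢_; _≗_; refl; sym; trans; cong; cong₂; module ≡-Reasoning)
open import Relation.Binary.Definitions using (tri<; tri≈; tri>)
open import Relation.Nullary using (contradiction)

init-shift : ∀ {n} {A : Set} (x : Vector A (suc n)) → init (shift x) ≗ tail x
init-shift {n} x i = cong x (toℕ-injective (begin
  toℕ (fromℕ< _)                 ≡⟨ toℕ-fromℕ< _ ⟩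
  suc (toℕ (inject₁ i)) % suc n  ≡⟨ cong (λ j → suc j % suc n) (toℕ-inject₁ i) ⟩
  suc (toℕ i) % suc n            ≡⟨ m<n⇒m%n≡m (s<s (toℕ<n i)) ⟩
  suc (toℕ i)                    ∎))
  where open ≡-Reasoning

last-shift : ∀ {n} {A : Set} (x : Vector A (suc n)) → last (shift x) ≡ head x
last-shift {n} x = cong x (toℕ-injective (begin
  toℕ (fromℕ< _)               ≡⟨ toℕ-fromℕ< _ ⟩
  suc (toℕ (fromℕ n)) % suc n  ≡⟨ cong (λ j → suc j % suc n) (toℕ-fromℕ n) ⟩
  suc n % suc n                ≡⟨ n%n≡0 (suc n) ⟩
  0                            ∎))
  where open ≡-Reasoning

sum-shift : ∀ {n} (x : Vector ℕ n) → sum (shift x) ≡ sum x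
sum-shift {zero}  x = refl
sum-shift {suc n} x = begin
  sum (shift x)                          ≡⟨ sum-init-last (shift x) ⟩
  sum (init (shift x)) + last (shift x)  ≡⟨ cong₂ _+_ (sum-cong-≗ (init-shift x)) (last-shift x) ⟩
  sum (tail x) + head x                  ≡⟨ +-comm (sum (tail x)) (head x) ⟩
  sum x                                  ∎
  where open ≡-Reasoning

odd-sum⇒2a+s≢2b+r : ∀ a b r s → IsOdd (r + s) → 2 * a + s ≢ 2 * b + r
odd-sum⇒2a+s≢2b+r a b r s odd e = contradiction (begin
  1                        ≡⟨ odd ⟨
  (r + s) % 2              ≡⟨ [m+kn]%n≡m%n (r + s) a 2 ⟨
  (r + s + a * 2) % 2      ≡⟨ cong (_% 2) (shuffle a r s) ⟩
  (r + (2 * a + s)) % 2    ≡⟨ cong (λ x → (r + x) % 2) e ⟩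
  (r + (2 * b + r)) % 2    ≡⟨ cong (_% 2) (double b r) ⟩
  ((b + r) * 2) % 2        ≡⟨ m*n%n≡0 (b + r) 2 ⟩
  0                        ∎) λ ()
  where
  open ≡-Reasoning
  shuffle : ∀ a r s → r + s + a * 2 ≡ r + (2 * a + s)
  shuffle = solve-∀
  double : ∀ b r → r + (2 * b + r) ≡ (b + r) * 2
  double = solve-∀

infix 4 _≡_[mod_]

_≡_[mod_] : ℕ → ℕ → (k : ℕ) → .{{NonZero k}} → Set
a ≡ b [mod k ] = a % k ≡ b % k

module _ {k : ℕ} .{{_ : NonZero k}} where

  +-cong-mod : ∀ {a b c d} → a ≡ b [mod k ] → c ≡ d [mod k ] → a + c ≡ b + d [mod k ]
  +-cong-mod {a} {b} {c} {d} a≡b c≡d = begin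
    (a + c) % k             ≡⟨ %-distribˡ-+ a c k ⟩
    (a % k + c % k) % k     ≡⟨ cong₂ (λ x y → (x + y) % k) a≡b c≡d ⟩
    (b % k + d % k) % k     ≡⟨ %-distribˡ-+ b d k ⟨
    (b + d) % k             ∎
    where open ≡-Reasoning

  ≡-mod∧quotient<⇒+≤ : ∀ {a b} → a ≡ b [mod k ] → a / k < b / k → a + k ≤ b
  ≡-mod∧quotient<⇒+≤ {a} {b} a≡b q< = begin
    a + k                     ≡⟨ cong (_+ k) (m≡m%n+[m/n]*n a k) ⟩
    a % k + a / k * k + k     ≡⟨ +-assoc (a % k) _ k ⟩
    a % k + (a / k * k + k)   ≡⟨ cong₂ (λ r x → r + x) a≡b (+-comm _ k) ⟩
    b % k + suc (a / k) * k   ≤⟨ +-monoʳ-≤ (b % k) (*-monoˡ-≤ k q<) ⟩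
    b % k + b / k * k         ≡⟨ m≡m%n+[m/n]*n b k ⟨
    b                         ∎
    where open ≤-Reasoning

  ≡-mod⇒≡⊎apart : ∀ {a b} → a ≡ b [mod k ] → a ≡ b ⊎ a + k ≤ b ⊎ b + k ≤ a
  ≡-mod⇒≡⊎apart {a} {b} a≡b with <-cmp (a / k) (b / k)
  ... | tri≈ _ q≡ _ = inj₁ (begin
    a                       ≡⟨ m≡m%n+[m/n]*n a k ⟩
    a % k + a / k * k       ≡⟨ cong₂ (λ r q → r + q * k) a≡b q≡ ⟩
    b % k + b / k * k       ≡⟨ m≡m%n+[m/n]*n b k ⟨
    b                       ∎)
    where open ≡-Reasoning
  ... | tri< q< _ _ = inj₂ (inj₁ (≡-mod∧quotient<⇒+≤ a≡b q<))
  ... | tri> _ _ q> = inj₂ (inj₂ (≡-mod∧quotient<⇒+≤ (sym a≡b) q>))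

  m/k≡n/k⇒m<n+k : ∀ {m n} → m / k ≡ n / k → m < n + k
  m/k≡n/k⇒m<n+k {m} {n} q≡ = begin-strict
    m                   ≡⟨ m≡m%n+[m/n]*n m k ⟩
    m % k + m / k * k   <⟨ +-monoˡ-< (m / k * k) (m%n<n m k) ⟩
    k + m / k * k       ≡⟨ cong (λ q → k + q * k) q≡ ⟩
    k + n / k * k       ≤⟨ +-monoʳ-≤ k (m/n*n≤m n k) ⟩
    k + n               ≡⟨ +-comm k n ⟩
    n + k               ∎
    where open ≤-Reasoning

  no-wraparound : ∀ {t t′ r s} → 3 * t < 3 * t′ + k → 3 * r ≤ k → 2 * t + r < 2 * t′ + s + k
  no-wraparound {t} {t′} {r} {s} 3t<3t′+k 3r≤k = *-cancelˡ-< 3 _ _ (begin-strict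
    3 * (2 * t + r)           ≡⟨ lhs t r ⟩
    2 * (3 * t) + 3 * r       <⟨ +-mono-<-≤ (*-monoʳ-< 2 3t<3t′+k) 3r≤k ⟩
    2 * (3 * t′ + k) + k      ≡⟨ rhs t′ k ⟩
    3 * (2 * t′ + k)          ≤⟨ *-monoʳ-≤ 3 (+-monoˡ-≤ k (m≤m+n (2 * t′) s)) ⟩
    3 * (2 * t′ + s + k)      ∎)
    where
    open ≤-Reasoning
    lhs : ∀ t r → 3 * (2 * t + r) ≡ 2 * (3 * t) + 3 * r
    lhs = solve-∀
    rhs : ∀ t k → 2 * (3 * t + k) + k ≡ 3 * (2 * t + k)
    rhs = solve-∀

  thirds-differ : ∀ {t t′ r s} → IsOdd (r + s) → 3 * (r + s) ≤ k →
                  2 * t′ + s ≡ 2 * t + r [mod k ] → 3 * t / k ≢ 3 * t′ / k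
  thirds-differ {t} {t′} {r} {s} odd 3[r+s]≤k t′≈t same-third = case ≡-mod⇒≡⊎apart t′≈t of λ where
      (inj₁ t′≡t)         → odd-sum⇒2a+s≢2b+r t′ t r s odd t′≡t
      (inj₂ (inj₁ wraps)) →
        <⇒≱ (no-wraparound {t} {t′} {r} {s} (m/k≡n/k⇒m<n+k same-third) (3x≤k (m≤m+n r s))) wraps
      (inj₂ (inj₂ wraps)) →
        <⇒≱ (no-wraparound {t′} {t} {s} {r} (m/k≡n/k⇒m<n+k (sym same-third)) (3x≤k (m≤n+m s r))) wraps
    where
    3x≤k : ∀ {x} → x ≤ r + s → 3 * x ≤ k
    3x≤k x≤ = ≤-trans (*-monoʳ-≤ 3 x≤) 3[r+s]≤k

  CycleEdge⇒step : ∀ {a b} → CycleEdge k a b →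
                   toℕ b ≡ suc (toℕ a) [mod k ] ⊎ suc (toℕ b) ≡ toℕ a [mod k ]
  CycleEdge⇒step (inj₁ b≡1+a) = inj₁ (trans (cong (_% k) b≡1+a) (m%n%n≡m%n _ k))
  CycleEdge⇒step (inj₂ a≡1+b) = inj₂ (sym (trans (cong (_% k) a≡1+b) (m%n%n≡m%n _ k)))

  sum-along-edges : ∀ {m} (u v : Vector (Fin k) m) → (∀ j → CycleEdge k (u j) (v j)) →
                    ∃₂ λ r s → r + s ≡ m × (sum (toℕ ∘ v) + s ≡ sum (toℕ ∘ u) + r [mod k ])
  sum-along-edges {zero}  u v adj = 0 , 0 , refl , refl
  sum-along-edges {suc m} u v adj =
    extend (CycleEdge⇒step (adj zero)) (sum-along-edges (tail u) (tail v) (adj ∘ suc))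
    where
    open ≡-Reasoning
    a = toℕ (head u)
    b = toℕ (head v)
    Σu = sum (toℕ ∘ tail u)
    Σv = sum (toℕ ∘ tail v)

    regroup : ∀ x y z → x + y + suc z ≡ suc x + (y + z)
    regroup = solve-∀

    extend : b ≡ suc a [mod k ] ⊎ suc b ≡ a [mod k ] →
             ∃₂ (λ r s → r + s ≡ m × (Σv + s ≡ Σu + r [mod k ])) →
             ∃₂ (λ r s → r + s ≡ suc m × (b + Σv + s ≡ a + Σu + r [mod k ]))
    extend (inj₁ up) (r , s , r+s≡m , tails) = suc r , s , cong suc r+s≡m , (begin
      (b + Σv + s) % k        ≡⟨ cong (_% k) (+-assoc b Σv s) ⟩
      (b + (Σv + s)) % k      ≡⟨ +-cong-mod up tails ⟩
      (suc a + (Σu + r)) % k  ≡⟨ cong (_% k) (regroup a Σu r) ⟨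
      (a + Σu + suc r) % k    ∎)
    extend (inj₂ down) (r , s , r+s≡m , tails) = r , suc s , trans (+-suc r s) (cong suc r+s≡m) , (begin
      (b + Σv + suc s) % k    ≡⟨ cong (_% k) (regroup b Σv s) ⟩
      (suc b + (Σv + s)) % k  ≡⟨ +-cong-mod down tails ⟩
      (a + (Σu + r)) % k      ≡⟨ cong (_% k) (+-assoc a Σu r) ⟨
      (a + Σu + r) % k        ∎)

≢⇒CycleEdge₃ : ∀ {a b : Fin 3} → a ≢ b → CycleEdge 3 a b
≢⇒CycleEdge₃ {zero}          {zero}          a≢b = contradiction refl a≢b
≢⇒CycleEdge₃ {zero}          {suc zero}      _   = inj₁ refl
≢⇒CycleEdge₃ {zero}          {suc (suc zero)} _  = inj₂ refl
≢⇒CycleEdge₃ {suc zero}      {zero}          _   = inj₂ refl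
≢⇒CycleEdge₃ {suc zero}      {suc zero}      a≢b = contradiction refl a≢b
≢⇒CycleEdge₃ {suc zero}      {suc (suc zero)} _  = inj₁ refl
≢⇒CycleEdge₃ {suc (suc zero)} {zero}          _  = inj₁ refl
≢⇒CycleEdge₃ {suc (suc zero)} {suc zero}      _  = inj₂ refl
≢⇒CycleEdge₃ {suc (suc zero)} {suc (suc zero)} a≢b = contradiction refl a≢b

IsPol-rearrange : ∀ {k l m n} .{{_ : NonZero k}} .{{_ : NonZero l}} {f : Op k m l} →
                  (σ : Fin m → Fin n) → IsPol k l m f → IsPol k l n (f ∘ rearrange σ)
IsPol-rearrange σ f-pol u v adj = f-pol (rearrange σ u) (rearrange σ v) (adj ∘ σ)

module SumColouring (k : ℕ) .{{_ : NonZero k}} (k-odd : IsOdd k) where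

  half : ℕ → ℕ
  half S = (suc (k / 2) * S) % k

  double-half : ∀ S → 2 * half S ≡ S [mod k ]
  double-half S = begin
    (2 * (hS % k)) % k                     ≡⟨ [m+kn]%n≡m%n (2 * (hS % k)) (2 * (hS / k)) k ⟨
    (2 * (hS % k) + 2 * (hS / k) * k) % k  ≡⟨ cong (_% k) (factor (hS % k) (hS / k) k) ⟩
    (2 * (hS % k + hS / k * k)) % k        ≡⟨ cong (λ x → (2 * x) % k) (m≡m%n+[m/n]*n hS k) ⟨
    (2 * hS) % k                           ≡⟨ cong (_% k) (double-inverse (k / 2) S) ⟩
    (S + S * (1 + k / 2 * 2)) % k          ≡⟨ cong (λ k′ → (S + S * k′) % k) k≡1+[k/2]*2 ⟨
    (S + S * k) % k                        ≡⟨ [m+kn]%n≡m%n S S k ⟩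
    S % k                                  ∎
    where
    open ≡-Reasoning
    hS = suc (k / 2) * S
    k≡1+[k/2]*2 : k ≡ 1 + k / 2 * 2
    k≡1+[k/2]*2 = trans (m≡m%n+[m/n]*n k 2) (cong (_+ k / 2 * 2) k-odd)
    factor : ∀ x y k → 2 * x + 2 * y * k ≡ 2 * (x + y * k)
    factor = solve-∀
    double-inverse : ∀ q S → 2 * (suc q * S) ≡ S + S * (1 + q * 2)
    double-inverse = solve-∀

  colour : ℕ → Fin 3
  colour S = fromℕ< {3 * half S / k} (m<n*o⇒m/o<n (*-monoʳ-< 3 (m%n<n (suc (k / 2) * S) k)))

  sumColour : (m : ℕ) → Op k m 3
  sumColour m x = colour (sum (toℕ ∘ x))

  sumColour-isPol : ∀ {m} → IsOdd m → 3 * m ≤ k → IsPol k 3 m (sumColour m)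
  sumColour-isPol m-odd 3m≤k u v adj = ≢⇒CycleEdge₃ colours-differ
    where
    Σu = sum (toℕ ∘ u)
    Σv = sum (toℕ ∘ v)
    colours-differ : colour Σu ≢ colour Σv
    colours-differ same with sum-along-edges u v adj
    ... | r , s , refl , Σv+s≈Σu+r = thirds-differ {t = half Σu} {half Σv} {r} {s} m-odd 3m≤k (begin
      (2 * half Σv + s) % k  ≡⟨ +-cong-mod (double-half Σv) refl ⟩
      (Σv + s) % k           ≡⟨ Σv+s≈Σu+r ⟩
      (Σu + r) % k           ≡⟨ +-cong-mod (double-half Σu) refl ⟨
      (2 * half Σu + r) % k  ∎) (fromℕ<-injective _ _ _ _ same)
      where open ≡-Reasoning

corollaryA2 : (k n : ℕ) → .{{_ : NonZero k}} → IsOdd k → 9 ≤ k → IsOdd n → 1 ≤ n → 3 * n ≤ k →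
    Σ (Op k n 3) λ c → Σ (Op k 6 3) λ s → Σ (Op k 6 3) λ o →
      (IsPol k 3 n c × IsPol k 3 6 s × IsPol k 3 6 o) ×
      (∀ (x : Fin n → Fin k) → c x ≡ c (shift x)) ×
      (∀ (x y z : Fin k) → s (tup6 x y x z y z) ≡ s (tup6 y x z x z y)) ×
      (∀ (x y : Fin k) → (o (tup6 x x y y y x) ≡ o (tup6 x y x y x y))
                       × (o (tup6 x y x y x y) ≡ o (tup6 y x x x y y)))
corollaryA2 k n k-odd 9≤k n-odd _ 3n≤k =
  sumColour n , sumColour 3 ∘ rearrange σ-s , sumColour 3 ∘ rearrange σ-o ,
  (sumColour-isPol n-odd 3n≤k , IsPol-rearrange σ-s ternary-isPol , IsPol-rearrange σ-o ternary-isPol) ,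
  (λ x → cong colour (sym (sum-shift (toℕ ∘ x)))) ,
  (λ x y z → cong colour (s-sums (toℕ x) (toℕ y) (toℕ z))) ,
  (λ x y → cong colour (o-sums₁ (toℕ x) (toℕ y)) , cong colour (o-sums₂ (toℕ x) (toℕ y)))
  where
  open SumColouring k k-odd
  ternary-isPol : IsPol k 3 3 (sumColour 3)
  ternary-isPol = sumColour-isPol refl 9≤k
  σ-s σ-o : Fin 3 → Fin 6
  σ-s = # 1 ∷ # 2 ∷ # 5 ∷ []
  σ-o = # 0 ∷ # 1 ∷ # 2 ∷ []
  s-sums : ∀ a b c → b + (a + (c + 0)) ≡ a + (c + (b + 0))
  s-sums = solve-∀
  o-sums₁ : ∀ a b → a + (a + (b + 0)) ≡ a + (b + (a + 0))
  o-sums₁ = solve-∀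
  o-sums₂ : ∀ a b → a + (b + (a + 0)) ≡ b + (a + (a + 0))
  o-sums₂ = solve-∀
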